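{- Let $N\ge 2$, $C\ge 1$, let $T_N$ be any request tournament, and let $B_1,\dots,B_W$ be any valid partition of $T_N$. Then $$W\ \ge\ \left\lceil\frac{N^2+\alpha}{8C}\right\rceil,\qquad \text{where } \alpha=\begin{cases}-1,& N\text{ odd},\\ 4,& N\equiv 2\pmod 4,\\ 8,& N\equiv 0 \pmod 4.\end{cases}$$
   Context: Let $\vec C_N$ be the directed cycle on vertices $0,1,\dots,N-1$ with arcs $(i,i+1 \bmod N)$. For distinct vertices $u,v$ let $d(u,v)=(v-u)\bmod N$ be the length of the directed path from $u$ to $v$ in $\vec C_N$. A request tournament $T_N$ is a tournament on $\{0,\dots,N-1\}$ containing every arc $(u,v)$ with $d(u,v)<N/2$ and, when $N$ is even, exactly one of the two arcs $(i,i+N/2)$, $(i+N/2,i)$ for each $0\le i<N/2$ (this choice being free). Each arc $(u,v)$ of $T_N$ is routed along the directed path from $u$ to $v$ in $\vec C_N$. For a subdigraph $B$ of $T_N$ and an arc $e$ of $\vec C_N$, the load $L(B,e)$ is the number of arcs of $B$ whose route contains $e$; $B$ is admissible (for grooming factor $C$) if $L(B,e)\le C$ for every arc $e$. A valid partition is a partition of the arc set of $T_N$ into admissible subdigraphs $B_1,\dots,B_W$. -}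

module Defs where

open import Data.Nat using (ℕ; zero; suc; _+_; _*_; _∸_; _≤_; _<_; _≤ᵇ_)
open import Data.Nat.DivMod using (_/_; _%_)
open import Data.Fin using (Fin; toℕ; _≟_)
open import Data.Bool using (Bool; true; false; not; if_then_else_; _∧_)
open import Data.Product using (_×_)
open import Relation.Nullary.Decidable using (⌊_⌋)
open import Relation.Binary.PropositionalEquality using (_≡_; _≢_)

-- d(u,v) = (v - u) mod N : length of the directed path u → v in the directed cycle C_N
dist : {N : ℕ} → Fin N → Fin N → ℕ
dist {N} u v = if toℕ u ≤ᵇ toℕ v then toℕ v ∸ toℕ u else (N + toℕ v) ∸ toℕ u

Digraph : ℕ → Set
Digraph N = Fin N → Fin N → Bool

IsTournament : {N : ℕ} → Digraph N → Set
IsTournament {N} T =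
  (∀ (u : Fin N) → T u u ≡ false) ×
  (∀ (u v : Fin N) → u ≢ v → T u v ≡ not (T v u))

-- request tournament: a tournament containing every arc (u,v) with d(u,v) < N/2
-- (the choice of the diametral arcs for even N is free, as in any tournament)
IsRequestTournament : {N : ℕ} → Digraph N → Set
IsRequestTournament {N} T =
  IsTournament T ×
  (∀ (u v : Fin N) → u ≢ v → 2 * dist u v < N → T u v ≡ true)

-- the arc e_j = (j, j+1 mod N) of C_N lies on the route u → v  iff  d(u,j) < d(u,v)
onRoute : {N : ℕ} → Fin N → Fin N → Fin N → Bool
onRoute u v j = suc (dist u j) ≤ᵇ dist u v

boolToℕ : Bool → ℕ
boolToℕ true = 1
boolToℕ false = 0

sumFin : (n : ℕ) → (Fin n → ℕ) → ℕ
sumFin zero f = 0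
sumFin (suc n) f = f Fin.zero + sumFin n (λ i → f (Fin.suc i))

-- A partition of the arcs of T into W (labelled) subdigraphs B_0..B_{W-1}
-- is given by a colouring c : arcs → Fin W (values on non-arcs are irrelevant).
-- load T c w j = L(B_w, e_j), the number of arcs of B_w whose route contains e_j.
load : {N W : ℕ} → Digraph N → (Fin N → Fin N → Fin W) → Fin W → Fin N → ℕ
load {N} T c w j =
  sumFin N (λ u → sumFin N (λ v →
    boolToℕ (T u v ∧ ⌊ c u v ≟ w ⌋ ∧ onRoute u v j)))

IsValidPartition : {N W : ℕ} → ℕ → Digraph N → (Fin N → Fin N → Fin W) → Set
IsValidPartition {N} {W} C T c = ∀ (w : Fin W) (j : Fin N) → load T c w j ≤ C

ceilDiv : ℕ → ℕ → ℕ
ceilDiv a zero = 0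
ceilDiv a (suc b) = (a + b) / suc b

numer : ℕ → ℕ
numer N with N % 4
... | 0 = N * N + 8
... | 2 = N * N + 4
... | _ = N * N ∸ 1

-- Summing the partition bound over the parts, every arc e_j of the cycle carries a total
-- load L(T, e_j) ≤ W C, so it suffices to find an arc with 8 L(T, e_j) ≥ N² + α.  Rotating
-- the cycle maps request tournaments to request tournaments and permutes the loads, so it
-- is enough to bound the load of e_{N-1} = (N-1, 0) for T and a few of its rotations.
-- That arc is crossed exactly by the arcs u → v of T with v < u.  Write N = 2m + ε: vertex
-- m + i has a request arc to every b < i, so L(T, e_{N-1}) ≥ 0 + 1 + ... + (m + ε - 1),
-- which is (N² - 1)/8 for odd N.  For even N add the number D(T) of diametral arcs
-- m + i → i.  Rotating by m reverses every diametral arc, so D(T) + D(rotate^m T) = m and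
-- one of them is at least ⌈m/2⌉, which settles N ≡ 2 (mod 4).  For N ≡ 0 (mod 4) this
-- gains the extra 1 unless D(T) = m/2; but one more rotation step changes D by exactly ±1,
-- so D(T) or D(rotate T) differs from m/2.
module Submission where

open import Defs
open import Data.Nat
open import Data.Nat.Properties
open import Data.Nat.DivMod
  using (_%_; _/_; _mod_; m%n<n; m<n⇒m%n≡m; n%n≡0; [m+n]%n≡m%n; %-distribˡ-+; m%n%n≡m%n;
         m≡m%n+[m/n]*n; m<n*o⇒m/o<n)
open import Data.Nat.Tactic.RingSolver using (solve-∀)
open import Data.Fin as Fin using (Fin; toℕ; fromℕ) renaming (zero to fzero; suc to fsuc)
open import Data.Fin.Properties using (toℕ<n; toℕ-injective; toℕ-fromℕ<; toℕ-fromℕ)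
  renaming (suc-injective to fsuc-injective)
open import Data.Bool using (Bool; true; false; _∧_; not; T)
open import Data.Bool.Properties using (T-≡; ∧-identityʳ; ∧-zeroʳ)
open import Data.Product using (_×_; _,_; proj₁)
open import Data.Sum using (_⊎_; inj₁; inj₂)
open import Function using (_∘_; Equivalence)
open import Relation.Nullary using (contradiction; yes; no)
open import Relation.Nullary.Decidable using (⌊_⌋; ⌊⌋-map′)
open import Relation.Binary.PropositionalEquality
open import Algebra.Properties.Semiring.Sum +-*-semiring
  using (sum; sum-cong-≗; sum-replicate-zero; ∑-comm; ∑-distrib-+; *-distribʳ-sum)

sumFin≡sum : ∀ n (f : Fin n → ℕ) → sumFin n f ≡ sum f
sumFin≡sum zero    f = refl
sumFin≡sum (suc n) f = cong (f fzero +_) (sumFin≡sum n (f ∘ fsuc))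

sum-mono-≤ : ∀ {n} {f g : Fin n → ℕ} → (∀ i → f i ≤ g i) → sum f ≤ sum g
sum-mono-≤ {zero}  f≤g = z≤n
sum-mono-≤ {suc n} f≤g = +-mono-≤ (f≤g fzero) (sum-mono-≤ (f≤g ∘ fsuc))

sum-≤-* : ∀ {n c} {f : Fin n → ℕ} → (∀ i → f i ≤ c) → sum f ≤ n * c
sum-≤-* {zero}  f≤c = z≤n
sum-≤-* {suc n} f≤c = +-mono-≤ (f≤c fzero) (sum-≤-* (f≤c ∘ fsuc))

sumℕ : ℕ → (ℕ → ℕ) → ℕ
sumℕ n g = sum {n} (g ∘ toℕ)

sumℕ-cong : ∀ n {g h : ℕ → ℕ} → (∀ i → i < n → g i ≡ h i) → sumℕ n g ≡ sumℕ n h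
sumℕ-cong n g≡h = sum-cong-≗ (λ i → g≡h (toℕ i) (toℕ<n i))

sumℕ-mono-≤ : ∀ n {g h : ℕ → ℕ} → (∀ i → i < n → g i ≤ h i) → sumℕ n g ≤ sumℕ n h
sumℕ-mono-≤ n g≤h = sum-mono-≤ (λ i → g≤h (toℕ i) (toℕ<n i))

sumℕ-const : ∀ n {c} {g : ℕ → ℕ} → (∀ i → i < n → g i ≡ c) → sumℕ n g ≡ n * c
sumℕ-const zero    g≡c = refl
sumℕ-const (suc n) g≡c =
  cong₂ _+_ (g≡c 0 z<s) (sumℕ-const n (λ i i<n → g≡c (suc i) (s<s i<n)))

sumℕ-distrib-+ : ∀ n (g h : ℕ → ℕ) → sumℕ n (λ i → g i + h i) ≡ sumℕ n g + sumℕ n h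
sumℕ-distrib-+ n g h = ∑-distrib-+ {n} (g ∘ toℕ) (h ∘ toℕ)

sumℕ-+ : ∀ p q (g : ℕ → ℕ) → sumℕ (p + q) g ≡ sumℕ p g + sumℕ q (λ i → g (p + i))
sumℕ-+ zero    q g = refl
sumℕ-+ (suc p) q g =
  trans (cong (g 0 +_) (sumℕ-+ p q (g ∘ suc))) (sym (+-assoc (g 0) _ _))

sumℕ-suc : ∀ n (g : ℕ → ℕ) → sumℕ (suc n) g ≡ sumℕ n g + g n
sumℕ-suc n g = begin
  sumℕ (suc n) g              ≡⟨ cong (λ k → sumℕ k g) (+-comm 1 n) ⟩
  sumℕ (n + 1) g              ≡⟨ sumℕ-+ n 1 g ⟩
  sumℕ n g + (g (n + 0) + 0)  ≡⟨ cong (sumℕ n g +_) (trans (+-identityʳ _) (cong g (+-identityʳ n))) ⟩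
  sumℕ n g + g n              ∎
  where open ≡-Reasoning

sumℕ-head : ∀ {n} (g : ℕ → ℕ) → 0 < n → g 0 ≤ sumℕ n g
sumℕ-head {suc n} g _ = m≤m+n _ _

sumℕ-rotate : ∀ n (g : ℕ → ℕ) → g n ≡ g 0 → sumℕ n (g ∘ suc) ≡ sumℕ n g
sumℕ-rotate n g gn≡g0 = +-cancelʳ-≡ (g 0) _ _ (begin
  sumℕ n (g ∘ suc) + g 0  ≡⟨ +-comm _ (g 0) ⟩
  sumℕ (suc n) g          ≡⟨ sumℕ-suc n g ⟩
  sumℕ n g + g n          ≡⟨ cong (sumℕ n g +_) gn≡g0 ⟩
  sumℕ n g + g 0          ∎)
  where open ≡-Reasoning

≤ᵇ-true : ∀ {m n} → m ≤ n → (m ≤ᵇ n) ≡ true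
≤ᵇ-true m≤n = Equivalence.to T-≡ (≤⇒≤ᵇ m≤n)

≤ᵇ-false : ∀ {m n} → n < m → (m ≤ᵇ n) ≡ false
≤ᵇ-false {m} {n} n<m with m ≤ᵇ n in eq
... | false = refl
... | true  = contradiction (≤ᵇ⇒≤ m n (subst T (sym eq) _)) (<⇒≱ n<m)

sumℕ-below : ∀ {n a} (p : ℕ → Bool) → a ≤ n →
  sumℕ n (λ b → boolToℕ (p b ∧ (suc b ≤ᵇ a))) ≡ sumℕ a (boolToℕ ∘ p)
sumℕ-below {n} {a} p a≤n = begin
  sumℕ n g                                   ≡⟨ cong (λ k → sumℕ k g) (m+[n∸m]≡n a≤n) ⟨
  sumℕ (a + (n ∸ a)) g                       ≡⟨ sumℕ-+ a (n ∸ a) g ⟩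
  sumℕ a g + sumℕ (n ∸ a) (λ t → g (a + t))  ≡⟨ cong₂ _+_ (sumℕ-cong a below) (sumℕ-const (n ∸ a) above) ⟩
  sumℕ a (boolToℕ ∘ p) + (n ∸ a) * 0         ≡⟨ cong (sumℕ a (boolToℕ ∘ p) +_) (*-zeroʳ (n ∸ a)) ⟩
  sumℕ a (boolToℕ ∘ p) + 0                   ≡⟨ +-identityʳ _ ⟩
  sumℕ a (boolToℕ ∘ p)                       ∎
  where
  open ≡-Reasoning
  g : ℕ → ℕ
  g b = boolToℕ (p b ∧ (suc b ≤ᵇ a))
  below : ∀ b → b < a → g b ≡ boolToℕ (p b)
  below b b<a = cong boolToℕ (trans (cong (p b ∧_) (≤ᵇ-true b<a)) (∧-identityʳ (p b)))
  above : ∀ t → t < n ∸ a → g (a + t) ≡ 0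
  above t _ = cong boolToℕ
    (trans (cong (p (a + t) ∧_) (≤ᵇ-false (s≤s (m≤m+n a t)))) (∧-zeroʳ (p (a + t))))

triangular : ℕ → ℕ
triangular k = sumℕ k (λ i → i)

triangular-double : ∀ k → 2 * triangular k + k ≡ k * k
triangular-double zero    = refl
triangular-double (suc k) = begin
  2 * triangular (suc k) + suc k        ≡⟨ cong (λ t → 2 * t + suc k) (sumℕ-suc k (λ i → i)) ⟩
  2 * (triangular k + k) + suc k        ≡⟨ regroup (triangular k) k ⟩
  (2 * triangular k + k) + (2 * k + 1)  ≡⟨ cong (_+ (2 * k + 1)) (triangular-double k) ⟩
  k * k + (2 * k + 1)                   ≡⟨ square-suc k ⟩
  suc k * suc k                         ∎
  where
  open ≡-Reasoning
  regroup : ∀ t k → 2 * (t + k) + suc k ≡ (2 * t + k) + (2 * k + 1)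
  regroup = solve-∀
  square-suc : ∀ k → k * k + (2 * k + 1) ≡ suc k * suc k
  square-suc = solve-∀

-- Loads

totalLoad : ∀ {N} → Digraph N → Fin N → ℕ
totalLoad T j = sum (λ u → sum (λ v → boolToℕ (T u v ∧ onRoute u v j)))

sum-indicator : ∀ {n} (x : Fin n) → sum (λ w → boolToℕ ⌊ x Fin.≟ w ⌋) ≡ 1
sum-indicator {suc n} fzero    = cong suc (sum-replicate-zero n)
sum-indicator {suc n} (fsuc x) = trans
  (sum-cong-≗ (λ w → cong boolToℕ (⌊⌋-map′ (cong fsuc) fsuc-injective (x Fin.≟ w))))
  (sum-indicator x)

boolToℕ-∧-middle : ∀ a b c → boolToℕ (a ∧ b ∧ c) ≡ boolToℕ b * boolToℕ (a ∧ c)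
boolToℕ-∧-middle false false c     = refl
boolToℕ-∧-middle false true  c     = refl
boolToℕ-∧-middle true  false c     = refl
boolToℕ-∧-middle true  true  false = refl
boolToℕ-∧-middle true  true  true  = refl

sum-select : ∀ {n} (x : Fin n) a c →
  sum (λ w → boolToℕ (a ∧ ⌊ x Fin.≟ w ⌋ ∧ c)) ≡ boolToℕ (a ∧ c)
sum-select x a c = begin
  sum (λ w → boolToℕ (a ∧ ⌊ x Fin.≟ w ⌋ ∧ c))
    ≡⟨ sum-cong-≗ (λ w → boolToℕ-∧-middle a ⌊ x Fin.≟ w ⌋ c) ⟩
  sum (λ w → boolToℕ ⌊ x Fin.≟ w ⌋ * boolToℕ (a ∧ c))
    ≡⟨ *-distribʳ-sum (boolToℕ (a ∧ c)) (λ w → boolToℕ ⌊ x Fin.≟ w ⌋) ⟨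
  sum (λ w → boolToℕ ⌊ x Fin.≟ w ⌋) * boolToℕ (a ∧ c)
    ≡⟨ cong (_* boolToℕ (a ∧ c)) (sum-indicator x) ⟩
  1 * boolToℕ (a ∧ c)
    ≡⟨ *-identityˡ _ ⟩
  boolToℕ (a ∧ c)
    ∎
  where open ≡-Reasoning

sum-load : ∀ {N W} (T : Digraph N) (c : Fin N → Fin N → Fin W) j →
  sum (λ w → load T c w j) ≡ totalLoad T j
sum-load {N} T c j = begin
  sum (λ w → sumFin N (λ u → sumFin N (λ v → E u v w)))
    ≡⟨ sum-cong-≗ (λ w → trans (sumFin≡sum N _)
                                (sum-cong-≗ (λ u → sumFin≡sum N (λ v → E u v w)))) ⟩
  sum (λ w → sum (λ u → sum (λ v → E u v w)))  ≡⟨ ∑-comm (λ w u → sum (λ v → E u v w)) ⟩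
  sum (λ u → sum (λ w → sum (λ v → E u v w)))
    ≡⟨ sum-cong-≗ (λ u → ∑-comm (λ w v → E u v w)) ⟩
  sum (λ u → sum (λ v → sum (E u v)))
    ≡⟨ sum-cong-≗ (λ u → sum-cong-≗ (λ v → sum-select (c u v) (T u v) (onRoute u v j))) ⟩
  totalLoad T j                                ∎
  where
  open ≡-Reasoning
  E : Fin N → Fin N → _ → ℕ
  E u v w = boolToℕ (T u v ∧ ⌊ c u v Fin.≟ w ⌋ ∧ onRoute u v j)

totalLoad-≤ : ∀ {N W} C (T : Digraph N) (c : Fin N → Fin N → Fin W) →
  IsValidPartition C T c → ∀ j → totalLoad T j ≤ W * C
totalLoad-≤ C T c valid j = subst (_≤ _) (sum-load T c j) (sum-≤-* (λ w → valid w j))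

back-arc-short : ∀ {ε m b i} → ε ≤ 1 → b < i → i < ε + m →
  2 * (ε + m + m + b ∸ (m + i)) < ε + m + m
back-arc-short {ε} {m} {b} {i} ε≤1 b<i i<ε+m =
  +-cancelʳ-≤ (2 * (m + i)) (suc (2 * x)) (ε + m + m) (begin
    suc (2 * x) + 2 * (m + i)              ≡⟨ cong suc (*-distribˡ-+ 2 x (m + i)) ⟨
    suc (2 * (x + (m + i)))                ≡⟨ cong (λ y → suc (2 * y)) (m∸n+n≡m m+i≤) ⟩
    suc (2 * (ε + m + m + b))              ≡⟨ regroup ε m b ⟩
    ε + m + m + 2 * m + (ε + suc (2 * b))  ≤⟨ +-monoʳ-≤ (ε + m + m + 2 * m) ε+1+2b≤2i ⟩
    ε + m + m + 2 * m + 2 * i              ≡⟨ ungroup ε m i ⟩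
    ε + m + m + 2 * (m + i)                ∎)
  where
  open ≤-Reasoning
  x : ℕ
  x = ε + m + m + b ∸ (m + i)
  m+i≤ : m + i ≤ ε + m + m + b
  m+i≤ = ≤-trans (≤-reflexive (+-comm m i))
                 (≤-trans (+-monoˡ-≤ m (<⇒≤ i<ε+m)) (m≤m+n (ε + m + m) b))
  double-suc : ∀ b → 1 + suc (2 * b) ≡ 2 * suc b
  double-suc = solve-∀
  ε+1+2b≤2i : ε + suc (2 * b) ≤ 2 * i
  ε+1+2b≤2i = ≤-trans (+-monoˡ-≤ (suc (2 * b)) ε≤1)
                      (≤-trans (≤-reflexive (double-suc b)) (*-monoʳ-≤ 2 b<i))
  regroup : ∀ ε m b → suc (2 * (ε + m + m + b)) ≡ ε + m + m + 2 * m + (ε + suc (2 * b))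
  regroup = solve-∀
  ungroup : ∀ ε m i → ε + m + m + 2 * m + 2 * i ≡ ε + m + m + 2 * (m + i)
  ungroup = solve-∀

larger-half : ∀ {a b k} → a + b ≡ suc (k + k) → k < a ⊎ k < b
larger-half {a} {b} {k} a+b≡ with k <? a
... | yes k<a = inj₁ k<a
... | no  k≮a = inj₂ (≰⇒> λ b≤k → 1+n≰n (subst (_≤ k + k) a+b≡ (+-mono-≤ (≮⇒≥ k≮a) b≤k)))

off-centre : ∀ {a b k} → a + b ≡ k + k → b ≢ k → k < a ⊎ k < b
off-centre {a} {b} {k} a+b≡ b≢k with k <? b
... | yes k<b = inj₂ k<b
... | no  k≮b = inj₁ (≰⇒> λ a≤k → <-irrefl a+b≡ (+-mono-≤-< a≤k (≤∧≢⇒< (≮⇒≥ k≮b) b≢k)))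

boolToℕ-not : ∀ b → boolToℕ (not b) + boolToℕ b ≡ 1
boolToℕ-not false = refl
boolToℕ-not true  = refl

m+m≢1 : ∀ m → m + m ≢ 1
m+m≢1 (suc m) eq = 1+n≢0 (trans (sym (+-suc m m)) (suc-injective eq))

square-double : ∀ m → (m + m) * (m + m) ≡ 8 * triangular m + 4 * m
square-double m = begin
  (m + m) * (m + m)           ≡⟨ four-squares m ⟩
  4 * (m * m)                 ≡⟨ cong (4 *_) (triangular-double m) ⟨
  4 * (2 * triangular m + m)  ≡⟨ expand (triangular m) m ⟩
  8 * triangular m + 4 * m    ∎
  where
  open ≡-Reasoning
  four-squares : ∀ m → (m + m) * (m + m) ≡ 4 * (m * m)
  four-squares = solve-∀
  expand : ∀ t m → 4 * (2 * t + m) ≡ 8 * t + 4 * m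
  expand = solve-∀

square-odd : ∀ m → suc (m + m) * suc (m + m) ∸ 1 ≡ 8 * triangular (suc m)
square-odd m = begin
  suc (m + m) * suc (m + m) ∸ 1        ≡⟨ cong (_∸ 1) (odd-square m) ⟩
  suc ((m + m) * (m + m) + 4 * m) ∸ 1  ≡⟨ cong (_+ 4 * m) (square-double m) ⟩
  8 * triangular m + 4 * m + 4 * m     ≡⟨ collect (triangular m) m ⟩
  8 * (triangular m + m)               ≡⟨ cong (8 *_) (sumℕ-suc m (λ i → i)) ⟨
  8 * triangular (suc m)               ∎
  where
  open ≡-Reasoning
  odd-square : ∀ m → suc (m + m) * suc (m + m) ≡ suc ((m + m) * (m + m) + 4 * m)
  odd-square = solve-∀
  collect : ∀ t m → 8 * t + 4 * m + 4 * m ≡ 8 * (t + m)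
  collect = solve-∀

square-twice-odd : ∀ k → let m = suc (k + k) in
  (m + m) * (m + m) + 4 ≡ 8 * (triangular m + suc k)
square-twice-odd k =
  trans (cong (_+ 4) (square-double (suc (k + k)))) (collect (triangular (suc (k + k))) k)
  where
  collect : ∀ t k → 8 * t + 4 * suc (k + k) + 4 ≡ 8 * (t + suc k)
  collect = solve-∀

square-twice-even : ∀ k → let m = k + k in
  (m + m) * (m + m) + 8 ≡ 8 * (triangular m + suc k)
square-twice-even k =
  trans (cong (_+ 8) (square-double (k + k))) (collect (triangular (k + k)) k)
  where
  collect : ∀ t k → 8 * t + 4 * (k + k) + 8 ≡ 8 * (t + suc k)
  collect = solve-∀

quadruple : ∀ q → q * 4 ≡ (q + q) + (q + q)
quadruple = solve-∀

quadruple-+2 : ∀ q → 2 + q * 4 ≡ suc (q + q) + suc (q + q)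
quadruple-+2 = solve-∀

ceilDiv-≤ : ∀ a b W → a ≤ suc b * W → ceilDiv a (suc b) ≤ W
ceilDiv-≤ a b W a≤ = s≤s⁻¹ (m<n*o⇒m/o<n (begin-strict
  a + b              <⟨ +-monoʳ-< a ≤-refl ⟩
  a + suc b          ≤⟨ +-monoˡ-≤ (suc b) (subst (a ≤_) (*-comm (suc b) W) a≤) ⟩
  W * suc b + suc b  ≡⟨ +-comm (W * suc b) (suc b) ⟩
  suc W * suc b      ∎))
  where open ≤-Reasoning

module _ {n : ℕ} where
  private
    N : ℕ
    N = suc n

  -- Rotating the cycle

  toℕ-mod-< : ∀ {x} → x < N → toℕ (x mod N) ≡ x
  toℕ-mod-< {x} x<N = trans (toℕ-fromℕ< (m%n<n x N)) (m<n⇒m%n≡m x<N)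

  mod-injective-< : ∀ {x y} → x < N → y < N → x mod N ≡ y mod N → x ≡ y
  mod-injective-< x<N y<N eq = trans (sym (toℕ-mod-< x<N)) (trans (cong toℕ eq) (toℕ-mod-< y<N))

  mod-cong-% : ∀ x y → x % N ≡ y % N → x mod N ≡ y mod N
  mod-cong-% x y x≡y = toℕ-injective
    (trans (toℕ-fromℕ< (m%n<n x N)) (trans x≡y (sym (toℕ-fromℕ< (m%n<n y N)))))

  mod-toℕ : ∀ (u : Fin N) → toℕ u mod N ≡ u
  mod-toℕ u = toℕ-injective (toℕ-mod-< (toℕ<n u))

  mod-+N : ∀ x → (N + x) mod N ≡ x mod N
  mod-+N x = mod-cong-% (N + x) x (trans (cong (_% N) (+-comm N x)) ([m+n]%n≡m%n x N))

  sum≡sumℕ-mod : ∀ (f : Fin N → ℕ) → sum f ≡ sumℕ N (λ x → f (x mod N))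
  sum≡sumℕ-mod f = sum-cong-≗ (cong f ∘ sym ∘ mod-toℕ)

  dist-≤ : ∀ {u v : Fin N} → toℕ u ≤ toℕ v → dist u v ≡ toℕ v ∸ toℕ u
  dist-≤ u≤v rewrite ≤ᵇ-true u≤v = refl

  dist-> : ∀ {u v : Fin N} → toℕ v < toℕ u → dist u v ≡ N + toℕ v ∸ toℕ u
  dist-> v<u rewrite ≤ᵇ-false v<u = refl

  rot : Fin N → Fin N
  rot u = suc (toℕ u) mod N

  rot-mod : ∀ x → rot (x mod N) ≡ suc x mod N
  rot-mod x = mod-cong-% (suc (toℕ (x mod N))) (suc x) (begin
    suc (toℕ (x mod N)) % N  ≡⟨ cong (λ y → suc y % N) (toℕ-fromℕ< (m%n<n x N)) ⟩
    (1 + x % N) % N          ≡⟨ %-distribˡ-+ 1 (x % N) N ⟩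
    (1 % N + x % N % N) % N  ≡⟨ cong (λ y → (1 % N + y) % N) (m%n%n≡m%n x N) ⟩
    (1 % N + x % N) % N      ≡⟨ %-distribˡ-+ 1 x N ⟨
    suc x % N                ∎)
    where open ≡-Reasoning

  toℕ-rot : ∀ (u : Fin N) →
    (toℕ u < n × toℕ (rot u) ≡ suc (toℕ u)) ⊎ (toℕ u ≡ n × toℕ (rot u) ≡ 0)
  toℕ-rot u with m<1+n⇒m<n∨m≡n (toℕ<n u)
  ... | inj₁ u<n = inj₁ (u<n , toℕ-mod-< (s<s u<n))
  ... | inj₂ u≡n = inj₂ (u≡n , trans (toℕ-fromℕ< _) (trans (cong (λ y → suc y % N) u≡n) (n%n≡0 N)))

  dist-rot : ∀ (u v : Fin N) → dist (rot u) (rot v) ≡ dist u v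
  dist-rot u v with toℕ-rot u | toℕ-rot v
  ... | inj₁ (u<n , ru) | inj₁ (v<n , rv) with ≤-<-connex (toℕ u) (toℕ v)
  ...   | inj₁ u≤v = begin
    dist (rot u) (rot v)           ≡⟨ dist-≤ (subst₂ _≤_ (sym ru) (sym rv) (s≤s u≤v)) ⟩
    toℕ (rot v) ∸ toℕ (rot u)      ≡⟨ cong₂ _∸_ rv ru ⟩
    toℕ v ∸ toℕ u                  ≡⟨ dist-≤ u≤v ⟨
    dist u v                       ∎
    where open ≡-Reasoning
  ...   | inj₂ v<u = begin
    dist (rot u) (rot v)           ≡⟨ dist-> (subst₂ _<_ (sym rv) (sym ru) (s<s v<u)) ⟩
    N + toℕ (rot v) ∸ toℕ (rot u)  ≡⟨ cong₂ (λ a b → N + a ∸ b) rv ru ⟩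
    N + suc (toℕ v) ∸ suc (toℕ u)  ≡⟨ cong (_∸ suc (toℕ u)) (+-suc N (toℕ v)) ⟩
    N + toℕ v ∸ toℕ u              ≡⟨ dist-> v<u ⟨
    dist u v                       ∎
    where open ≡-Reasoning
  dist-rot u v | inj₂ (u≡n , ru) | inj₁ (v<n , rv) = begin
    dist (rot u) (rot v)           ≡⟨ dist-≤ (subst (_≤ toℕ (rot v)) (sym ru) z≤n) ⟩
    toℕ (rot v) ∸ toℕ (rot u)      ≡⟨ cong₂ _∸_ rv ru ⟩
    suc (toℕ v)                    ≡⟨ m+n∸m≡n n (suc (toℕ v)) ⟨
    n + suc (toℕ v) ∸ n            ≡⟨ cong₂ _∸_ (+-suc n (toℕ v)) (sym u≡n) ⟩
    N + toℕ v ∸ toℕ u              ≡⟨ dist-> (subst (toℕ v <_) (sym u≡n) v<n) ⟨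
    dist u v                       ∎
    where open ≡-Reasoning
  dist-rot u v | inj₁ (u<n , ru) | inj₂ (v≡n , rv) = begin
    dist (rot u) (rot v)           ≡⟨ dist-> (subst₂ _<_ (sym rv) (sym ru) z<s) ⟩
    N + toℕ (rot v) ∸ toℕ (rot u)  ≡⟨ cong₂ (λ a b → N + a ∸ b) rv ru ⟩
    n + 0 ∸ toℕ u                  ≡⟨ cong (_∸ toℕ u) (trans (+-identityʳ n) (sym v≡n)) ⟩
    toℕ v ∸ toℕ u                  ≡⟨ dist-≤ (subst (toℕ u ≤_) (sym v≡n) (<⇒≤ u<n)) ⟨
    dist u v                       ∎
    where open ≡-Reasoning
  dist-rot u v | inj₂ (u≡n , ru) | inj₂ (v≡n , rv) = begin
    dist (rot u) (rot v)           ≡⟨ dist-≤ (subst₂ _≤_ (sym ru) (sym rv) ≤-refl) ⟩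
    toℕ (rot v) ∸ toℕ (rot u)      ≡⟨ cong₂ _∸_ rv ru ⟩
    0                              ≡⟨ n∸n≡0 n ⟨
    n ∸ n                          ≡⟨ cong₂ _∸_ (sym v≡n) (sym u≡n) ⟩
    toℕ v ∸ toℕ u                  ≡⟨ dist-≤ (subst₂ _≤_ (sym u≡n) (sym v≡n) ≤-refl) ⟨
    dist u v                       ∎
    where open ≡-Reasoning

  rot-injective : ∀ {u v : Fin N} → rot u ≡ rot v → u ≡ v
  rot-injective {u} {v} eq with toℕ-rot u | toℕ-rot v
  ... | inj₁ (_ , ru) | inj₁ (_ , rv) =
    toℕ-injective (suc-injective (trans (sym ru) (trans (cong toℕ eq) rv)))
  ... | inj₁ (_ , ru) | inj₂ (_ , rv) = contradiction (trans (sym ru) (trans (cong toℕ eq) rv)) 1+n≢0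
  ... | inj₂ (_ , ru) | inj₁ (_ , rv) = contradiction (trans (sym rv) (trans (cong toℕ (sym eq)) ru)) 1+n≢0
  ... | inj₂ (u≡n , _) | inj₂ (v≡n , _) = toℕ-injective (trans u≡n (sym v≡n))

  onRoute-rot : ∀ (u v j : Fin N) → onRoute (rot u) (rot v) (rot j) ≡ onRoute u v j
  onRoute-rot u v j = cong₂ (λ a b → suc a ≤ᵇ b) (dist-rot u j) (dist-rot u v)

  sum-rot : ∀ (f : Fin N → ℕ) → sum (f ∘ rot) ≡ sum f
  sum-rot f = begin
    sumℕ N (g ∘ suc)
      ≡⟨ sumℕ-rotate N g (cong f (trans (cong (_mod N) (sym (+-identityʳ N))) (mod-+N 0))) ⟩
    sumℕ N g          ≡⟨ sum≡sumℕ-mod f ⟨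
    sum f             ∎
    where
    open ≡-Reasoning
    g : ℕ → ℕ
    g x = f (x mod N)

  rotate : Digraph N → Digraph N
  rotate T u v = T (rot u) (rot v)

  rotate^ : ℕ → Digraph N → Digraph N
  rotate^ zero    T = T
  rotate^ (suc r) T = rotate (rotate^ r T)

  totalLoad-rotate : ∀ (T : Digraph N) j → totalLoad (rotate T) j ≡ totalLoad T (rot j)
  totalLoad-rotate T j = begin
    sum (λ u → sum (λ v → boolToℕ (T (rot u) (rot v) ∧ onRoute u v j)))
      ≡⟨ sum-cong-≗ (λ u → sum-cong-≗ (λ v →
           cong (λ b → boolToℕ (T (rot u) (rot v) ∧ b)) (sym (onRoute-rot u v j)))) ⟩
    sum (λ u → sum (λ v → load′ (rot u) (rot v)))  ≡⟨ sum-cong-≗ (λ u → sum-rot (load′ (rot u))) ⟩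
    sum (λ u → sum (load′ (rot u)))                ≡⟨ sum-rot (λ u → sum (load′ u)) ⟩
    totalLoad T (rot j)                            ∎
    where
    open ≡-Reasoning
    load′ : Fin N → Fin N → ℕ
    load′ u v = boolToℕ (T u v ∧ onRoute u v (rot j))

  rotate-isRequestTournament : ∀ {T : Digraph N} →
    IsRequestTournament T → IsRequestTournament (rotate T)
  rotate-isRequestTournament ((loopless , oriented) , request) =
    (loopless ∘ rot , λ u v u≢v → oriented (rot u) (rot v) (u≢v ∘ rot-injective)) ,
    λ u v u≢v short → request (rot u) (rot v) (u≢v ∘ rot-injective)
                        (subst (λ d → 2 * d < N) (sym (dist-rot u v)) short)

  BoundedRequest : ℕ → Digraph N → Set
  BoundedRequest X T = IsRequestTournament T × (∀ j → totalLoad T j ≤ X)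

  rotate-bounded : ∀ {X T} → BoundedRequest X T → BoundedRequest X (rotate T)
  rotate-bounded {X} {T} (isRequest , bounded) =
    rotate-isRequestTournament isRequest ,
    λ j → subst (_≤ X) (sym (totalLoad-rotate T j)) (bounded (rot j))

  rotate^-bounded : ∀ {X T} r → BoundedRequest X T → BoundedRequest X (rotate^ r T)
  rotate^-bounded zero    b = b
  rotate^-bounded (suc r) b = rotate-bounded (rotate^-bounded r b)

  arc : Digraph N → ℕ → ℕ → ℕ
  arc T x y = boolToℕ (T (x mod N) (y mod N))

  arc-rotate^ : ∀ r T x y → arc (rotate^ r T) x y ≡ arc T (r + x) (r + y)
  arc-rotate^ zero    T x y = refl
  arc-rotate^ (suc r) T x y = begin
    boolToℕ (rotate^ r T (rot (x mod N)) (rot (y mod N)))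
      ≡⟨ cong₂ (λ u v → boolToℕ (rotate^ r T u v)) (rot-mod x) (rot-mod y) ⟩
    arc (rotate^ r T) (suc x) (suc y)  ≡⟨ arc-rotate^ r T (suc x) (suc y) ⟩
    arc T (r + suc x) (r + suc y)      ≡⟨ cong₂ (arc T) (+-suc r x) (+-suc r y) ⟩
    arc T (suc r + x) (suc r + y)      ∎
    where open ≡-Reasoning

  arc-+N : ∀ T x y → arc T (N + x) y ≡ arc T x y
  arc-+N T x y = cong (λ u → boolToℕ (T u (y mod N))) (mod-+N x)

  arc-flip : ∀ {T : Digraph N} {x y} → IsTournament T → x < N → y < N → x ≢ y →
    arc T y x + arc T x y ≡ 1
  arc-flip {T} {x} {y} (_ , oriented) x<N y<N x≢y =
    trans (cong (λ b → boolToℕ b + arc T x y)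
                (oriented (y mod N) (x mod N) (x≢y ∘ sym ∘ mod-injective-< y<N x<N)))
          (boolToℕ-not (T (x mod N) (y mod N)))

  -- The load of the arc e_{N-1} from N - 1 to 0

  dist-fromℕ : ∀ (u : Fin N) → dist u (fromℕ n) ≡ n ∸ toℕ u
  dist-fromℕ u = trans (dist-≤ (subst (toℕ u ≤_) (sym (toℕ-fromℕ n)) (s≤s⁻¹ (toℕ<n u))))
                       (cong (_∸ toℕ u) (toℕ-fromℕ n))

  onRoute-wrap : ∀ (u v : Fin N) → onRoute u v (fromℕ n) ≡ (suc (toℕ v) ≤ᵇ toℕ u)
  onRoute-wrap u v with ≤-<-connex (toℕ u) (toℕ v)
  ... | inj₁ u≤v = begin
    suc (dist u (fromℕ n)) ≤ᵇ dist u v  ≡⟨ cong₂ (λ a b → suc a ≤ᵇ b) (dist-fromℕ u) (dist-≤ u≤v) ⟩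
    suc (n ∸ toℕ u) ≤ᵇ (toℕ v ∸ toℕ u)  ≡⟨ ≤ᵇ-false (s≤s (∸-monoˡ-≤ (toℕ u) (s≤s⁻¹ (toℕ<n v)))) ⟩
    false                               ≡⟨ ≤ᵇ-false (s≤s u≤v) ⟨
    suc (toℕ v) ≤ᵇ toℕ u                ∎
    where open ≡-Reasoning
  ... | inj₂ v<u = begin
    suc (dist u (fromℕ n)) ≤ᵇ dist u v  ≡⟨ cong₂ (λ a b → suc a ≤ᵇ b) (dist-fromℕ u) (dist-> v<u) ⟩
    suc (n ∸ toℕ u) ≤ᵇ (N + toℕ v ∸ toℕ u)
      ≡⟨ ≤ᵇ-true (≤-trans (≤-reflexive (sym (+-∸-assoc 1 (s≤s⁻¹ (toℕ<n u)))))
                          (∸-monoˡ-≤ (toℕ u) (m≤m+n N (toℕ v)))) ⟩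
    true                                ≡⟨ ≤ᵇ-true v<u ⟨
    suc (toℕ v) ≤ᵇ toℕ u                ∎
    where open ≡-Reasoning

  backArcs : Digraph N → ℕ → ℕ
  backArcs T a = sumℕ a (arc T a)

  totalLoad-wrap : ∀ (T : Digraph N) → totalLoad T (fromℕ n) ≡ sumℕ N (backArcs T)
  totalLoad-wrap T = begin
    sum (λ u → sum (λ v → boolToℕ (T u v ∧ onRoute u v (fromℕ n))))
      ≡⟨ sum-cong-≗ (λ u → sum-cong-≗ (λ v →
           cong (λ b → boolToℕ (T u v ∧ b)) (onRoute-wrap u v))) ⟩
    sum (λ u → sum (backward u))
      ≡⟨ trans (sum≡sumℕ-mod (λ u → sum (backward u)))
               (sumℕ-cong N (λ a _ → sum≡sumℕ-mod (backward (a mod N)))) ⟩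
    sumℕ N (λ a → sumℕ N (λ b → backward (a mod N) (b mod N)))
      ≡⟨ sumℕ-cong N (λ a a<N → sumℕ-cong N (λ b b<N →
           cong₂ (λ x y → boolToℕ (T (a mod N) (b mod N) ∧ (suc x ≤ᵇ y)))
                 (toℕ-mod-< b<N) (toℕ-mod-< a<N))) ⟩
    sumℕ N (λ a → sumℕ N (λ b → boolToℕ (T (a mod N) (b mod N) ∧ (suc b ≤ᵇ a))))
      ≡⟨ sumℕ-cong N (λ a a<N → sumℕ-below (λ b → T (a mod N) (b mod N)) (<⇒≤ a<N)) ⟩
    sumℕ N (backArcs T)
      ∎
    where
    open ≡-Reasoning
    backward : Fin N → Fin N → ℕ
    backward u v = boolToℕ (T u v ∧ (suc (toℕ v) ≤ᵇ toℕ u))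

  -- N = ε + m + m with ε ≤ 1 treats both parities at once; ε comes first so that the
  -- instances ε = 0 and ε = 1 reduce to m + m and suc (m + m).
  request-back-arc : ∀ {T : Digraph N} {ε m b i} → IsRequestTournament T →
    N ≡ ε + m + m → ε ≤ 1 → b < i → i < ε + m → arc T (m + i) b ≡ 1
  request-back-arc {T} {ε} {m} {b} {i} (_ , request) N≡ ε≤1 b<i i<ε+m = cong boolToℕ
    (request ((m + i) mod N) (b mod N) (<⇒≢ b<m+i ∘ sym ∘ mod-injective-< m+i<N b<N) short)
    where
    m+i<N : m + i < N
    m+i<N = subst₂ _<_ (+-comm i m) (sym N≡) (+-monoˡ-< m i<ε+m)
    b<m+i : b < m + i
    b<m+i = ≤-trans b<i (m≤n+m i m)
    b<N : b < N
    b<N = <-trans b<m+i m+i<N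
    short : 2 * dist ((m + i) mod N) (b mod N) < N
    short = begin-strict
      2 * dist ((m + i) mod N) (b mod N)
        ≡⟨ cong (2 *_) (trans (dist-> (subst₂ _<_ (sym (toℕ-mod-< b<N)) (sym (toℕ-mod-< m+i<N)) b<m+i))
                              (cong₂ (λ x y → N + x ∸ y) (toℕ-mod-< b<N) (toℕ-mod-< m+i<N))) ⟩
      2 * (N + b ∸ (m + i))          ≡⟨ cong (λ K → 2 * (K + b ∸ (m + i))) N≡ ⟩
      2 * (ε + m + m + b ∸ (m + i))  <⟨ back-arc-short ε≤1 b<i i<ε+m ⟩
      ε + m + m                      ≡⟨ N≡ ⟨
      N                              ∎
      where open ≤-Reasoning

  backArcs-request : ∀ {T : Digraph N} {ε m i} → IsRequestTournament T →
    N ≡ ε + m + m → ε ≤ 1 → i < ε + m →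
    backArcs T (m + i) ≡ i + sumℕ m (λ t → arc T (m + i) (i + t))
  backArcs-request {T} {ε} {m} {i} isRequest N≡ ε≤1 i<ε+m = begin
    sumℕ (m + i) (arc T (m + i))   ≡⟨ cong (λ k → sumℕ k (arc T (m + i))) (+-comm m i) ⟩
    sumℕ (i + m) (arc T (m + i))   ≡⟨ sumℕ-+ i m (arc T (m + i)) ⟩
    sumℕ i (arc T (m + i)) + rest
      ≡⟨ cong (_+ rest) (sumℕ-const i (λ b b<i → request-back-arc isRequest N≡ ε≤1 b<i i<ε+m)) ⟩
    i * 1 + rest                   ≡⟨ cong (_+ rest) (*-identityʳ i) ⟩
    i + rest                       ∎
    where
    open ≡-Reasoning
    rest : ℕ
    rest = sumℕ m (λ t → arc T (m + i) (i + t))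

  wrap-load-≥ : ∀ {T : Digraph N} ε m → IsRequestTournament T → N ≡ ε + m + m → ε ≤ 1 →
    sumℕ (ε + m) (λ i → i + sumℕ m (λ t → arc T (m + i) (i + t))) ≤ totalLoad T (fromℕ n)
  wrap-load-≥ {T} ε m isRequest N≡ ε≤1 = begin
    sumℕ (ε + m) (λ i → i + sumℕ m (λ t → arc T (m + i) (i + t)))
      ≡⟨ sumℕ-cong (ε + m) (λ i i<ε+m → backArcs-request isRequest N≡ ε≤1 i<ε+m) ⟨
    sumℕ (ε + m) (λ i → backArcs T (m + i))
      ≤⟨ m≤n+m _ (sumℕ m (backArcs T)) ⟩
    sumℕ m (backArcs T) + sumℕ (ε + m) (λ i → backArcs T (m + i))
      ≡⟨ sumℕ-+ m (ε + m) (backArcs T) ⟨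
    sumℕ (m + (ε + m)) (backArcs T)
      ≡⟨ cong (λ k → sumℕ k (backArcs T)) (trans (+-comm m (ε + m)) (sym N≡)) ⟩
    sumℕ N (backArcs T)
      ≡⟨ totalLoad-wrap T ⟨
    totalLoad T (fromℕ n)
      ∎
    where open ≤-Reasoning

  wrap-load-odd : ∀ {T : Digraph N} m → IsRequestTournament T → N ≡ suc (m + m) →
    triangular (suc m) ≤ totalLoad T (fromℕ n)
  wrap-load-odd {T} m isRequest N≡ =
    ≤-trans (sumℕ-mono-≤ (suc m) (λ i _ → m≤m+n i (sumℕ m (λ t → arc T (m + i) (i + t)))))
            (wrap-load-≥ 1 m isRequest N≡ (s≤s z≤n))

  -- For N = m + m: the diametral arcs oriented m + i → i, i.e. those crossing e_{N-1}.
  wrappingDiameters : Digraph N → ℕ → ℕ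
  wrappingDiameters T m = sumℕ m (λ i → arc T (m + i) i)

  wrap-load-even : ∀ {T : Digraph N} m → IsRequestTournament T → N ≡ m + m →
    triangular m + wrappingDiameters T m ≤ totalLoad T (fromℕ n)
  wrap-load-even {T} m isRequest N≡ = ≤-trans (begin
    triangular m + wrappingDiameters T m
      ≡⟨ sumℕ-distrib-+ m (λ i → i) (λ i → arc T (m + i) i) ⟨
    sumℕ m (λ i → i + arc T (m + i) i)
      ≤⟨ sumℕ-mono-≤ m (λ i i<m → +-monoʳ-≤ i (first-term i i<m)) ⟩
    sumℕ m (λ i → i + sumℕ m (λ t → arc T (m + i) (i + t)))
      ∎)
    (wrap-load-≥ 0 m isRequest N≡ z≤n)
    where
    open ≤-Reasoning
    first-term : ∀ i → i < m → arc T (m + i) i ≤ sumℕ m (λ t → arc T (m + i) (i + t))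
    first-term i i<m = subst (_≤ sumℕ m (λ t → arc T (m + i) (i + t)))
      (cong (arc T (m + i)) (+-identityʳ i))
      (sumℕ-head (λ t → arc T (m + i) (i + t)) (≤-<-trans z≤n i<m))

  wrappingDiameters-antipodal : ∀ {T : Digraph N} m → IsTournament T → N ≡ m + m →
    wrappingDiameters (rotate^ m T) m + wrappingDiameters T m ≡ m
  wrappingDiameters-antipodal {T} m isTournament N≡ = begin
    wrappingDiameters (rotate^ m T) m + wrappingDiameters T m
      ≡⟨ sumℕ-distrib-+ m (λ i → arc (rotate^ m T) (m + i) i) (λ i → arc T (m + i) i) ⟨
    sumℕ m (λ i → arc (rotate^ m T) (m + i) i + arc T (m + i) i)  ≡⟨ sumℕ-const m antipodes ⟩
    m * 1                                                        ≡⟨ *-identityʳ m ⟩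
    m                                                            ∎
    where
    open ≡-Reasoning
    antipodes : ∀ i → i < m → arc (rotate^ m T) (m + i) i + arc T (m + i) i ≡ 1
    antipodes i i<m = begin
      arc (rotate^ m T) (m + i) i + arc T (m + i) i
        ≡⟨ cong (_+ arc T (m + i) i) (arc-rotate^ m T (m + i) i) ⟩
      arc T (m + (m + i)) (m + i) + arc T (m + i) i
        ≡⟨ cong (λ x → arc T x (m + i) + arc T (m + i) i)
                (trans (sym (+-assoc m m i)) (cong (_+ i) (sym N≡))) ⟩
      arc T (N + i) (m + i) + arc T (m + i) i
        ≡⟨ cong (_+ arc T (m + i) i) (arc-+N T i (m + i)) ⟩
      arc T i (m + i) + arc T (m + i) i
        ≡⟨ arc-flip isTournament m+i<N i<N (<⇒≢ (m<n+m i (≤-<-trans z≤n i<m)) ∘ sym) ⟩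
      1 ∎
      where
      m+i<N : m + i < N
      m+i<N = subst (m + i <_) (sym N≡) (+-monoʳ-< m i<m)
      i<N : i < N
      i<N = ≤-<-trans (m≤n+m i m) m+i<N

  -- Rotating by one drops the diameter at i = 0 and adds the one at i = m, its reverse.
  wrappingDiameters-rotate : ∀ {T : Digraph N} m → IsTournament T → 0 < m → N ≡ m + m →
    wrappingDiameters (rotate T) m ≢ wrappingDiameters T m
  wrappingDiameters-rotate {T} m isTournament 0<m N≡ rotate≡ =
    m+m≢1 (arc T m 0) (trans (cong (arc T m 0 +_) h0≡hm) (arc-flip isTournament z<s m<N (<⇒≢ 0<m)))
    where
    h : ℕ → ℕ
    h i = arc T (m + i) i
    m<N : m < N
    m<N = subst (m <_) (sym N≡) (m<m+n m 0<m)
    shifted : wrappingDiameters (rotate T) m ≡ sumℕ m (h ∘ suc)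
    shifted = sumℕ-cong m (λ i _ →
      trans (arc-rotate^ 1 T (m + i) i) (cong (λ x → arc T x (suc i)) (sym (+-suc m i))))
    h0≡hm : arc T m 0 ≡ arc T 0 m
    h0≡hm = begin
      arc T m 0        ≡⟨ cong (λ x → arc T x 0) (+-identityʳ m) ⟨
      h 0              ≡⟨ +-cancelˡ-≡ (wrappingDiameters T m) _ _ (begin
        wrappingDiameters T m + h 0  ≡⟨ +-comm _ (h 0) ⟩
        h 0 + wrappingDiameters T m  ≡⟨ cong (h 0 +_) (trans (sym rotate≡) shifted) ⟩
        sumℕ (suc m) h               ≡⟨ sumℕ-suc m h ⟩
        wrappingDiameters T m + h m  ∎) ⟩
      arc T (m + m) m  ≡⟨ cong (λ x → arc T x m) (trans (sym N≡) (sym (+-identityʳ N))) ⟩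
      arc T (N + 0) m  ≡⟨ arc-+N T 0 m ⟩
      arc T 0 m        ∎
      where open ≡-Reasoning

  -- Lower bounds on the maximal load

  even-bound : ∀ {X k} {T : Digraph N} m → BoundedRequest X T → N ≡ m + m →
    k < wrappingDiameters T m → triangular m + suc k ≤ X
  even-bound {X} {k} {T} m (isRequest , bounded) N≡ k<D = begin
    triangular m + suc k                  ≤⟨ +-monoʳ-≤ (triangular m) k<D ⟩
    triangular m + wrappingDiameters T m  ≤⟨ wrap-load-even m isRequest N≡ ⟩
    totalLoad T (fromℕ n)                 ≤⟨ bounded (fromℕ n) ⟩
    X                                     ∎
    where open ≤-Reasoning

  antipodal-bound : ∀ {X k} {T : Digraph N} m → BoundedRequest X T → N ≡ m + m →
    k < wrappingDiameters (rotate^ m T) m ⊎ k < wrappingDiameters T m → triangular m + suc k ≤ X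
  antipodal-bound m b N≡ (inj₁ k<D) = even-bound m (rotate^-bounded m b) N≡ k<D
  antipodal-bound m b N≡ (inj₂ k<D) = even-bound m b N≡ k<D

  odd-bound : ∀ {X} {T : Digraph N} m → BoundedRequest X T → N ≡ suc (m + m) →
    N * N ∸ 1 ≤ 8 * X
  odd-bound {X} m (isRequest , bounded) N≡ = begin
    N * N ∸ 1                      ≡⟨ cong (λ K → K * K ∸ 1) N≡ ⟩
    suc (m + m) * suc (m + m) ∸ 1  ≡⟨ square-odd m ⟩
    8 * triangular (suc m)
      ≤⟨ *-monoʳ-≤ 8 (≤-trans (wrap-load-odd m isRequest N≡) (bounded (fromℕ n))) ⟩
    8 * X                          ∎
    where open ≤-Reasoning

  twice-odd-bound : ∀ {X} {T : Digraph N} k → BoundedRequest X T →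
    N ≡ suc (k + k) + suc (k + k) → N * N + 4 ≤ 8 * X
  twice-odd-bound {X} k b@((isTournament , _) , _) N≡ = begin
    N * N + 4                   ≡⟨ cong (λ K → K * K + 4) N≡ ⟩
    (m + m) * (m + m) + 4       ≡⟨ square-twice-odd k ⟩
    8 * (triangular m + suc k)  ≤⟨ *-monoʳ-≤ 8 (antipodal-bound m b N≡
                                     (larger-half (wrappingDiameters-antipodal m isTournament N≡))) ⟩
    8 * X                       ∎
    where
    open ≤-Reasoning
    m : ℕ
    m = suc (k + k)

  -- If D(T) = k then D(rotate T) ≠ k, and one of the two antipodal pairs is unbalanced.
  twice-even-bound : ∀ {X} {T : Digraph N} k → BoundedRequest X T →
    N ≡ (k + k) + (k + k) → N * N + 8 ≤ 8 * X
  twice-even-bound {X} {T} k b@((isTournament , _) , _) N≡ = begin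
    N * N + 8                   ≡⟨ cong (λ K → K * K + 8) N≡ ⟩
    (m + m) * (m + m) + 8       ≡⟨ square-twice-even k ⟩
    8 * (triangular m + suc k)  ≤⟨ *-monoʳ-≤ 8 unbalanced ⟩
    8 * X                       ∎
    where
    open ≤-Reasoning
    m : ℕ
    m = k + k
    0<m : 0 < m
    0<m = ≤∧≢⇒< z≤n (λ 0≡m → 1+n≢0 (trans N≡ (cong (λ x → x + x) (sym 0≡m))))
    unbalanced : triangular m + suc k ≤ X
    unbalanced with wrappingDiameters T m ≟ k
    ... | no  D≢k = antipodal-bound m b N≡ (off-centre (wrappingDiameters-antipodal m isTournament N≡) D≢k)
    ... | yes D≡k = antipodal-bound m (rotate-bounded b) N≡
      (off-centre (wrappingDiameters-antipodal m (proj₁ (proj₁ (rotate-bounded b))) N≡)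
                  (λ D′≡k → wrappingDiameters-rotate m isTournament 0<m N≡ (trans D′≡k (sym D≡k))))

load-lower-bound : ∀ {n X} {T : Digraph (suc n)} → BoundedRequest X T → numer (suc n) ≤ 8 * X
load-lower-bound {n} b with suc n % 4 | m≡m%n+[m/n]*n (suc n) 4 | m%n<n (suc n) 4
... | 0 | N≡ | _ = twice-even-bound (suc n / 4) b (trans N≡ (quadruple (suc n / 4)))
... | 1 | N≡ | _ = odd-bound (suc n / 4 + suc n / 4) b (trans N≡ (cong suc (quadruple (suc n / 4))))
... | 2 | N≡ | _ = twice-odd-bound (suc n / 4) b (trans N≡ (quadruple-+2 (suc n / 4)))
... | 3 | N≡ | _ = odd-bound (suc (suc n / 4 + suc n / 4)) b (trans N≡ (cong suc (quadruple-+2 (suc n / 4))))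
... | suc (suc (suc (suc _))) | _ | s≤s (s≤s (s≤s (s≤s ())))

proposition1 : (N C W : ℕ) → 2 ≤ N → 1 ≤ C →
  (T : Digraph N) → IsRequestTournament T →
  (c : Fin N → Fin N → Fin W) → IsValidPartition C T c →
  ceilDiv (numer N) (8 * C) ≤ W
proposition1 (suc n) (suc C) W (s≤s _) (s≤s _) T isRequest c valid =
  ceilDiv-≤ (numer (suc n)) _ W (begin
    numer (suc n)    ≤⟨ load-lower-bound (isRequest , totalLoad-≤ (suc C) T c valid) ⟩
    8 * (W * suc C)  ≡⟨ reorder W (suc C) ⟩
    8 * suc C * W    ∎)
  where
  open ≤-Reasoning
  reorder : ∀ W C → 8 * (W * C) ≡ 8 * C * W
  reorder = solve-∀
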